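{- Let $M=(S,S_0,\Delta)$ be the counter system of disjunctive process templates $A,B$, and let $\lessapprox\ \subseteq S\times S$ be defined by $(q_A,\vec c)\lessapprox(q'_A,\vec d)$ iff $q_A=q'_A$ and $\vec c\le\vec d$ componentwise. Then $(M,\lessapprox)$ is a well-structured transition system, i.e., $\lessapprox$ is a well-quasi-order on $S$ and $\lessapprox$ is compatible with $\Delta$: for all $s,s',r\in S$, if $s\to s'$ and $s\lessapprox r$, then there exists $r'\in S$ with $s'\lessapprox r'$ and $r\to^* r'$ (reachable in zero or more transitions).
   Context: Let $Q_A,Q_B$ be disjoint finite sets and $Q=Q_A\cup Q_B$. A (disjunctive) process template is $U=(Q_U,\mathit{init}_U,\mathcal G_U,\delta_U)$ for $U\in\{A,B\}$, with $\mathit{init}_U\in Q_U$, a set of guards $\mathcal G_U\subseteq\mathcal P(Q)$, and a transition relation $\delta_U\subseteq Q_U\times\mathcal G_U\times Q_U$ which is total (every $q\in Q_U$ has an outgoing transition). Write $Q_B=\{q_0,\dots,q_{|B|-1}\}$ and $\vec u_i$ for the $i$-th unit vector. The counter system $M=(S,S_0,\Delta)$ has states $S=Q_A\times\mathbb N_0^{|B|}$ (a state $(q_A,\vec c)$ records the state of the single $A$-process and, in $\vec c(i)$, the number of $B$-processes in $q_i$), initial states $S_0=\{(\mathit{init}_A,\vec c)\mid \vec c(q)=0 \text{ for all } q\neq \mathit{init}_B\}$, and $((q_A,\vec c),(q'_A,\vec c'))\in\Delta$ iff either (1) $\vec c'=\vec c$ and there is $(q_A,g,q'_A)\in\delta_A$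 such that some $q_i\in g\cap Q_B$ has $\vec c(i)\ge1$; or (2) $q'_A=q_A$ and there is $(q_i,g,q_j)\in\delta_B$ with $\vec c(i)\ge1$, $\vec c'=\vec c-\vec u_i+\vec u_j$, and the guard is satisfied, meaning: $q_A\in g$, or some $q_l\in g\cap Q_B$ with $l\neq i$ has $\vec c(l)\ge1$, or $q_i\in g$ and $\vec c(i)\ge2$. A transition based on local transition $t$ is written $s\xrightarrow{t}s'$. A well-quasi-order on $S$ is a reflexive, transitive relation such that every infinite sequence $s_0,s_1,\dots$ contains $s_i\preceq s_j$ with $i<j$. -}

module Defs where

open import Data.Nat using (ℕ; _≤_; _<_; _+_; _∸_)
open import Data.Fin using (Fin)
open import Data.Fin.Properties using () renaming (_≟_ to _≟ᶠ_)
open import Data.Bool using (Bool; true; false)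
open import Data.Sum using (_⊎_; inj₁; inj₂)
open import Data.Product using (_×_; _,_; Σ; ∃; ∃-syntax)
open import Data.List using (List)
open import Data.List.Membership.Propositional using (_∈_)
open import Relation.Nullary using (¬_; yes; no)
open import Relation.Binary.PropositionalEquality using (_≡_)
open import Relation.Binary.Construct.Closure.ReflexiveTransitive using (Star)

Q : ℕ → ℕ → Set
Q nA nB = Fin nA ⊎ Fin nB

Guard : ℕ → ℕ → Set
Guard nA nB = Q nA nB → Bool

-- A process template with local states Fin n.  The set of guards G_U is the
-- set of guards occurring in the (finite) transition relation δ.
record Template (nA nB n : ℕ) : Set where
  field
    init  : Fin n
    δ     : List (Fin n × Guard nA nB × Fin n)
    total : ∀ q → ∃[ g ] ∃[ q' ] ((q , g , q') ∈ δ)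

State : ℕ → ℕ → Set
State nA nB = Fin nA × (Fin nB → ℕ)

[_≟_] : ∀ {n} → Fin n → Fin n → ℕ
[ k ≟ i ] with k ≟ᶠ i
... | yes _ = 1
... | no  _ = 0

module CounterSystem {nA nB : ℕ} (A : Template nA nB nA) (B : Template nA nB nB) where
  open Template

  Initial : State nA nB → Set
  Initial (qA , c) = qA ≡ init A × (∀ q → ¬ (q ≡ init B) → c q ≡ 0)

  GuardSatB : Guard nA nB → Fin nB → State nA nB → Set
  GuardSatB g i (qA , c) =
      g (inj₁ qA) ≡ true
    ⊎ (∃[ l ] (¬ (l ≡ i) × g (inj₂ l) ≡ true × 1 ≤ c l))
    ⊎ (g (inj₂ i) ≡ true × 2 ≤ c i)

  data Step : State nA nB → State nA nB → Set where
    stepA : ∀ {qA qA' c g} → (qA , g , qA') ∈ δ A →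
            (∃[ i ] (g (inj₂ i) ≡ true × 1 ≤ c i)) →
            Step (qA , c) (qA' , c)
    stepB : ∀ {qA c c' g i j} → (i , g , j) ∈ δ B →
            1 ≤ c i →
            (∀ k → c' k ≡ (c k ∸ [ k ≟ i ]) + [ k ≟ j ]) →
            GuardSatB g i (qA , c) →
            Step (qA , c) (qA , c')

  Steps : State nA nB → State nA nB → Set
  Steps = Star Step

_⪅_ : ∀ {nA nB} → State nA nB → State nA nB → Set
(qA , c) ⪅ (qA' , d) = qA ≡ qA' × (∀ k → c k ≤ d k)

record WQO (S : Set) (_≼_ : S → S → Set) : Set where
  field
    refl  : ∀ s → s ≼ s
    trans : ∀ {s t u} → s ≼ t → t ≼ u → s ≼ u
    good  : (f : ℕ → S) → ∃[ i ] ∃[ j ] (i < j × f i ≼ f j)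

module _ {nA nB : ℕ} (A : Template nA nB nA) (B : Template nA nB nB) where
  open CounterSystem A B

  Compatible : Set
  Compatible = ∀ {s s' r} → Step s s' → s ⪅ r → ∃[ r' ] (s' ⪅ r' × Steps r r')

  IsWSTS : Set
  IsWSTS = WQO (State nA nB) _⪅_ × Compatible

{-# OPTIONS --safe #-}
-- The order ⪅ is the product of equality on the finite set Q_A and the pointwise order
-- on ℕ^|B|, hence a wqo by Dickson's lemma.  To extract a good pair from an arbitrary
-- sequence constructively we work with almost-full relations (Vytiniotis, Coquand and
-- Wahlstedt): they yield good pairs, are closed under inverse images, and, by a
-- Ramsey-type argument, under intersections.  Compatibility is simulation in one step:
-- guards only ask for counters ≥ 1 or ≥ 2, so a larger state fires the same local
-- transition, and the same counter update keeps it larger.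
module Submission where

open import Defs
open import Data.Nat using (ℕ; zero; suc; _≤_; _<_; _+_; _∸_; z≤n; s≤s; _≤?_)
open import Data.Nat.Properties
  using (≤-refl; ≤-reflexive; ≤-trans; ≤-pred; ≤-antisym; ≰⇒>; <⇒≤; +-monoˡ-≤; ∸-monoˡ-≤; ∸-monoʳ-≤; ∸-cancelˡ-≡)
open import Data.Fin using (Fin; toℕ) renaming (zero to fzero; suc to fsuc)
open import Data.Fin.Properties using (toℕ-injective; toℕ<n)
open import Data.Sum as Sum using (_⊎_; inj₁; inj₂; [_,_])
open import Data.Product using (_×_; _,_; proj₁; proj₂; ∃-syntax)
open import Data.Product.Relation.Binary.Pointwise.NonDependent as Product using ()
open import Data.Vec.Functional.Relation.Binary.Pointwise as Vector using ()
open import Data.Vec.Functional using (head; tail; uncons)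
open import Data.Empty.Polymorphic using (⊥-elim)
open import Function using (_∘_; id; _on_)
open import Level using (0ℓ)
open import Relation.Nullary using (yes; no)
open import Relation.Binary.Core using (Rel)
open import Relation.Binary.Construct.Union using (_∪_)
open import Relation.Binary.Construct.Intersection using (_∩_)
open import Relation.Binary.Construct.Constant using (Const)
open import Relation.Binary.Construct.Never using (Never)
open import Relation.Binary.PropositionalEquality using (_≡_; refl; trans)
open import Relation.Binary.Construct.Closure.ReflexiveTransitive using (ε; _◅_)

private
  variable
    X Y : Set
    A B R S T : Rel X 0ℓ

_↑_ : Rel X 0ℓ → X → Rel X 0ℓ
(R ↑ x) y z = R y z ⊎ R x y

-- _⇒_ with explicit points: with implicit ones Agda cannot infer the relations from a hypothesis.
infix 4 _⇒′_

_⇒′_ : Rel X 0ℓ → Rel X 0ℓ → Set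
R ⇒′ S = ∀ x y → R x y → S x y

data AlmostFull {X : Set} : Rel X 0ℓ → Set₁ where
  now   : (∀ x y → R x y) → AlmostFull R
  later : (∀ x → AlmostFull (R ↑ x)) → AlmostFull R

AlmostFull-mono : R ⇒′ S → AlmostFull R → AlmostFull S
AlmostFull-mono R⇒S (now r)   = now λ x y → R⇒S x y (r x y)
AlmostFull-mono R⇒S (later r) = later λ x →
  AlmostFull-mono (λ y z → Sum.map (R⇒S y z) (R⇒S x y)) (r x)

AlmostFull-on : (f : Y → X) → AlmostFull R → AlmostFull (R on f)
AlmostFull-on f (now r)   = now λ x y → r (f x) (f y)
AlmostFull-on f (later r) = later λ x → AlmostFull-on f (r (f x))

almostFull⇒good : AlmostFull R → (f : ℕ → X) → ∃[ i ] ∃[ j ] (i < j × R (f i) (f j))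
almostFull⇒good (now r)   f = 0 , 1 , s≤s z≤n , r (f 0) (f 1)
almostFull⇒good (later r) f with almostFull⇒good (r (f 0)) (f ∘ suc)
... | i , j , i<j , inj₁ fi≤fj = suc i , suc j , s≤s i<j , fi≤fj
... | i , j , i<j , inj₂ f0≤fi = 0 , suc i , s≤s z≤n , f0≤fi

First : (X → Set) → Rel X 0ℓ
First P y _ = P y

⊎-×-merge : ∀ {c p q : Set} → c ⊎ p → c ⊎ q → c ⊎ (p × q)
⊎-×-merge (inj₁ r) _        = inj₁ r
⊎-×-merge (inj₂ p) (inj₁ r) = inj₁ r
⊎-×-merge (inj₂ p) (inj₂ q) = inj₂ (p , q)

⊎-swapʳ : ∀ {a b c : Set} → (a ⊎ b) ⊎ c → (a ⊎ c) ⊎ b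
⊎-swapʳ = Sum.assocˡ ∘ Sum.map₂ Sum.swap ∘ Sum.assocʳ

⊎-medial : ∀ {a b c d : Set} → (a ⊎ b) ⊎ (c ⊎ d) → (a ⊎ c) ⊎ (b ⊎ d)
⊎-medial = [ Sum.map inj₁ inj₁ , Sum.map inj₂ inj₂ ]

↑-⇒′-split : ∀ x → A ⇒′ R ∪ S → A ↑ x ⇒′ ((R ↑ x) ∪ First (S x)) ∪ S
↑-⇒′-split x A⇒ y z = [ Sum.map₁ (inj₁ ∘ inj₁) ∘ A⇒ y z , inj₁ ∘ Sum.map₁ inj₂ ∘ A⇒ x y ]

↑-⇒′-weaken : ∀ {U : Rel X 0ℓ} x → A ⇒′ R ∪ S → A ⇒′ ((R ↑ x) ∪ U) ∪ S
↑-⇒′-weaken x A⇒ y z = Sum.map₁ (inj₁ ∘ inj₁) ∘ A⇒ y z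

∪-∩-almostFullˡ : (∀ x y → A x y) → AlmostFull B →
                  A ⇒′ R ∪ S → B ⇒′ R ∪ T → AlmostFull (R ∪ (S ∩ T))
∪-∩-almostFullˡ a B-af A⇒ B⇒ =
  AlmostFull-mono (λ y z → ⊎-×-merge (A⇒ y z (a y z)) ∘ B⇒ y z) B-af

∪-∩-almostFullʳ : AlmostFull A → (∀ x y → B x y) →
                  A ⇒′ R ∪ S → B ⇒′ R ∪ T → AlmostFull (R ∪ (S ∩ T))
∪-∩-almostFullʳ A-af b A⇒ B⇒ =
  AlmostFull-mono (λ y z a → ⊎-×-merge (A⇒ y z a) (B⇒ y z (b y z))) A-af

-- Intersection is generalised to R ∪ (S ∩ T).  Induction on both almost-full proofs
-- leaves, after ↑ x, the extra disjuncts S x and T x, which depend on one argument fewer;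
-- hence three stages, for S and T of arity 0, 1 and 2.
∪-∩-almostFull₀ : ∀ {P Q : Set} → AlmostFull A → AlmostFull B →
                  A ⇒′ R ∪ Const P → B ⇒′ R ∪ Const Q → AlmostFull (R ∪ (Const P ∩ Const Q))
∪-∩-almostFull₀ (now a)   B-af A⇒ B⇒ = ∪-∩-almostFullˡ a B-af A⇒ B⇒
∪-∩-almostFull₀ (later h) B-af A⇒ B⇒ = later λ x →
  AlmostFull-mono (λ _ _ → ⊎-medial ∘ Sum.assocʳ ∘ inj₁) (∪-∩-almostFull₀ (h x) B-af
    (λ y z → [ Sum.map₁ inj₁ ∘ A⇒ y z , Sum.map₁ inj₂ ∘ A⇒ x y ])
    (λ y z → Sum.map₁ inj₁ ∘ B⇒ y z))

∪-∩-almostFull₁ : ∀ {P Q : X → Set} → AlmostFull A → AlmostFull B →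
                  A ⇒′ R ∪ First P → B ⇒′ R ∪ First Q → AlmostFull (R ∪ (First P ∩ First Q))
∪-∩-almostFull₁ (now a)   B-af      A⇒ B⇒ = ∪-∩-almostFullˡ a B-af A⇒ B⇒
∪-∩-almostFull₁ A-af      (now b)   A⇒ B⇒ = ∪-∩-almostFullʳ A-af b A⇒ B⇒
∪-∩-almostFull₁ (later h) (later k) A⇒ B⇒ = later λ x →
  AlmostFull-mono (λ _ _ → ⊎-medial ∘ Sum.assocʳ) (∪-∩-almostFull₀
    (∪-∩-almostFull₁ (h x) (later k) (↑-⇒′-split x A⇒) (↑-⇒′-weaken x B⇒))
    (∪-∩-almostFull₁ (later h) (k x) (↑-⇒′-weaken x A⇒) (↑-⇒′-split x B⇒))
    (λ _ _ → ⊎-swapʳ) (λ _ _ → ⊎-swapʳ))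

∪-∩-almostFull₂ : AlmostFull A → AlmostFull B →
                  A ⇒′ R ∪ S → B ⇒′ R ∪ T → AlmostFull (R ∪ (S ∩ T))
∪-∩-almostFull₂ (now a)   B-af      A⇒ B⇒ = ∪-∩-almostFullˡ a B-af A⇒ B⇒
∪-∩-almostFull₂ A-af      (now b)   A⇒ B⇒ = ∪-∩-almostFullʳ A-af b A⇒ B⇒
∪-∩-almostFull₂ (later h) (later k) A⇒ B⇒ = later λ x →
  AlmostFull-mono (λ _ _ → ⊎-medial ∘ Sum.assocʳ) (∪-∩-almostFull₁
    (∪-∩-almostFull₂ (h x) (later k) (↑-⇒′-split x A⇒) (↑-⇒′-weaken x B⇒))
    (∪-∩-almostFull₂ (later h) (k x) (↑-⇒′-weaken x A⇒) (↑-⇒′-split x B⇒))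
    (λ _ _ → ⊎-swapʳ) (λ _ _ → ⊎-swapʳ))

∩-almostFull : AlmostFull R → AlmostFull S → AlmostFull (R ∩ S)
∩-almostFull R-af S-af = AlmostFull-mono (λ _ _ → [ ⊥-elim , id ])
  (∪-∩-almostFull₂ {R = Never} R-af S-af (λ _ _ → inj₂) (λ _ _ → inj₂))

≤↑-almostFull : ∀ x → AlmostFull (_≤_ ↑ x)
≤↑-almostFull zero    = now λ _ _ → inj₂ z≤n
≤↑-almostFull (suc x) = later after
  where
  after : ∀ y → AlmostFull ((_≤_ ↑ suc x) ↑ y)
  after y with suc x ≤? y
  ... | yes x<y = now λ _ _ → inj₂ (inj₂ x<y)
  ... | no  x≮y = AlmostFull-mono
    (λ _ _ → Sum.map inj₁ (inj₁ ∘ ≤-trans (≤-pred (≰⇒> x≮y))))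
    (≤↑-almostFull x)

≤-almostFull : AlmostFull _≤_
≤-almostFull = later ≤↑-almostFull

-- Equality on Fin n is ≤ ∩ ≥, and i ↦ n ∸ toℕ i turns ≥ into ≤.
≡-almostFull : ∀ n → AlmostFull {Fin n} _≡_
≡-almostFull n = AlmostFull-mono ≤∩≥⇒≡
  (∩-almostFull (AlmostFull-on toℕ ≤-almostFull) (AlmostFull-on (λ i → n ∸ toℕ i) ≤-almostFull))
  where
  ≤∩≥⇒≡ : ∀ i j → toℕ i ≤ toℕ j × n ∸ toℕ i ≤ n ∸ toℕ j → i ≡ j
  ≤∩≥⇒≡ i j (i≤j , n∸i≤n∸j) = toℕ-injective (∸-cancelˡ-≡ (<⇒≤ (toℕ<n i)) (<⇒≤ (toℕ<n j))
    (≤-antisym n∸i≤n∸j (∸-monoʳ-≤ n i≤j)))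

×-almostFull : ∀ {R : Rel X 0ℓ} {S : Rel Y 0ℓ} →
               AlmostFull R → AlmostFull S → AlmostFull (Product.Pointwise R S)
×-almostFull R-af S-af = ∩-almostFull (AlmostFull-on proj₁ R-af) (AlmostFull-on proj₂ S-af)

Pointwise-almostFull : ∀ n → AlmostFull R → AlmostFull (Vector.Pointwise R {n})
Pointwise-almostFull zero    R-af = now λ _ _ ()
Pointwise-almostFull {R = R} (suc n) R-af = AlmostFull-mono cons
  (AlmostFull-on uncons (×-almostFull R-af (Pointwise-almostFull n R-af)))
  where
  cons : ∀ c d → R (head c) (head d) × Vector.Pointwise R (tail c) (tail d) →
         Vector.Pointwise R c d
  cons c d (r , rs) fzero    = r
  cons c d (r , rs) (fsuc k) = rs k

⪅-almostFull : ∀ nA nB → AlmostFull (_⪅_ {nA} {nB})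
⪅-almostFull nA nB = ×-almostFull (≡-almostFull nA) (Pointwise-almostFull nB ≤-almostFull)

⪅-wqo : ∀ nA nB → WQO (State nA nB) _⪅_
⪅-wqo nA nB = record
  { refl  = λ _ → refl , λ _ → ≤-refl
  ; trans = λ (p≡q , c≤d) (q≡r , d≤e) → trans p≡q q≡r , λ k → ≤-trans (c≤d k) (d≤e k)
  ; good  = almostFull⇒good (⪅-almostFull nA nB)
  }

module _ {nA nB : ℕ} (A : Template nA nB nA) (B : Template nA nB nB) where
  open CounterSystem A B

  GuardSatB-mono : ∀ {g i qA} {c d : Fin nB → ℕ} → (∀ k → c k ≤ d k) →
                   GuardSatB g i (qA , c) → GuardSatB g i (qA , d)
  GuardSatB-mono c≤d (inj₁ g-qA) = inj₁ g-qA
  GuardSatB-mono c≤d (inj₂ (inj₁ (l , l≢i , g-l , 1≤cl))) =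
    inj₂ (inj₁ (l , l≢i , g-l , ≤-trans 1≤cl (c≤d l)))
  GuardSatB-mono {i = i} c≤d (inj₂ (inj₂ (g-i , 2≤ci))) =
    inj₂ (inj₂ (g-i , ≤-trans 2≤ci (c≤d i)))

  compatible : Compatible A B
  compatible {r = _ , d} (stepA t (l , g-l , 1≤cl)) (refl , c≤d) =
    _ , (refl , c≤d) , stepA t (l , g-l , ≤-trans 1≤cl (c≤d l)) ◅ ε
  compatible {r = _ , d} (stepB {g = g} {i} {j} t 1≤ci c′≡ sat) (refl , c≤d) =
    (_ , λ k → (d k ∸ [ k ≟ i ]) + [ k ≟ j ]) ,
    (refl , λ k → ≤-trans (≤-reflexive (c′≡ k)) (+-monoˡ-≤ [ k ≟ j ] (∸-monoˡ-≤ [ k ≟ i ] (c≤d k)))) ,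
    stepB t (≤-trans 1≤ci (c≤d i)) (λ _ → refl) (GuardSatB-mono {g} c≤d sat) ◅ ε

lemma1 : (nA nB : ℕ) (A : Template nA nB nA) (B : Template nA nB nB) → IsWSTS A B
lemma1 nA nB A B = ⪅-wqo nA nB , compatible A B
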